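{- Let $I$ and $J$ be finite subsets of $\mathbb{N}=\{0,1,2,\dots\}$ with $I\sim J$. Then $z_I=z_J$ (as cardinalities, possibly infinite).
   Context: For a subset $I\subseteq\mathbb{N}$, let $\mathcal{Z}_I=\{(q,a)\in\mathbb{Z}^2 : \gcd(q,a)\text{ is squarefree},\ q\neq 0,\ qi+a\text{ is the square of an integer for all } i\in I\}$ and $z_I=\#\mathcal{Z}_I$. For a finite $I\subseteq\mathbb{N}$ define three elementary operations: (i) translation: for $i\in\mathbb{Z}$ such that $\min(I)+i\ge 0$, $I+i=\{j\in\mathbb{N} : j-i\in I\}$; (ii) scaling: for $r\in\mathbb{Q}\setminus\{0\}$ with $ri\in\mathbb{N}$ for all $i\in I$, $rI=\{ri : i\in I\}$; (iii) symmetry: if $I=\{n_0<\dots<n_k\}$, $I^s=\{n_0+n_k-i : i\in I\}$. Two finite subsets $I,J\subseteq\mathbb{N}$ are equivalent, $I\sim J$, if there is a finite chain $I=I_0,I_1,\dots,I_m=J$ of finite subsets of $\mathbb{N}$ in which each $I_{t+1}$ is obtained from $I_t$ by one of the operations (i)–(iii). -}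

module Defs where

open import Data.Nat as ℕ using (ℕ; _≤_)
open import Data.Nat.Divisibility using (_∣_)
open import Data.Nat.GCD using (gcd)
open import Data.Integer as ℤ using (ℤ; +_; ∣_∣)
open import Data.Rational as ℚ using (ℚ; _/_; 0ℚ)
open import Data.List using (List)
open import Data.List.Membership.Propositional using (_∈_)
open import Data.Product using (Σ; ∃; ∃-syntax; _×_; _,_; proj₁)
open import Relation.Nullary using (¬_)
open import Relation.Binary.PropositionalEquality using (_≡_)
open import Relation.Binary.Construct.Closure.ReflexiveTransitive using (Star)
open import Function.Bundles using (_⇔_)

-- A finite subset of ℕ is represented by a list of its elements
-- (order and repetitions are irrelevant; only membership matters).
FinSubset : Set
FinSubset = List ℕ

SquareFree : ℕ → Set
SquareFree n = ∀ (d : ℕ) → (d ℕ.* d) ∣ n → d ≡ 1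

InZ : FinSubset → ℤ × ℤ → Set
InZ I (q , a) =
  SquareFree (gcd ∣ q ∣ ∣ a ∣) ×
  ¬ (q ≡ + 0) ×
  (∀ (i : ℕ) → i ∈ I → ∃[ k ] (q ℤ.* + i ℤ.+ a ≡ k ℤ.* k))

Z : FinSubset → Set
Z I = Σ (ℤ × ℤ) (InZ I)

ℕtoℚ : ℕ → ℚ
ℕtoℚ n = (+ n) / 1

Translation : FinSubset → FinSubset → Set
Translation I J = ∃[ i ]
  ((∀ n → n ∈ I → ℤ.0ℤ ℤ.≤ (+ n) ℤ.+ i) ×
   (∀ j → (j ∈ J) ⇔ (∃[ n ] (n ∈ I × (+ j) ≡ (+ n) ℤ.+ i))))

Scaling : FinSubset → FinSubset → Set
Scaling I J = ∃[ r ]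
  (¬ (r ≡ 0ℚ) ×
   (∀ n → n ∈ I → ∃[ m ] (r ℚ.* ℕtoℚ n ≡ ℕtoℚ m)) ×
   (∀ j → (j ∈ J) ⇔ (∃[ n ] (n ∈ I × ℕtoℚ j ≡ r ℚ.* ℕtoℚ n))))

Symmetry : FinSubset → FinSubset → Set
Symmetry I J = ∃[ n₀ ] ∃[ nₖ ]
  (n₀ ∈ I × nₖ ∈ I × (∀ n → n ∈ I → n₀ ≤ n × n ≤ nₖ) ×
   (∀ j → (j ∈ J) ⇔ (∃[ n ] (n ∈ I × j ℕ.+ n ≡ n₀ ℕ.+ nₖ))))

data Step (I J : FinSubset) : Set where
  translation : Translation I J → Step I J
  scaling     : Scaling I J → Step I J
  symmetry    : Symmetry I J → Step I J

_∼_ : FinSubset → FinSubset → Set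
I ∼ J = Star Step I J

-- equal cardinality of the subsets 𝒵_I, 𝒵_J ⊆ ℤ²: a bijection between
-- the underlying subsets (maps on Σ-types that respect and are inverse
-- up to equality of the underlying pair (q , a))
record SameCard (A B : FinSubset) : Set where
  field
    to      : Z A → Z B
    from    : Z B → Z A
    to-wd   : ∀ x y → proj₁ x ≡ proj₁ y → proj₁ (to x) ≡ proj₁ (to y)
    from-wd : ∀ x y → proj₁ x ≡ proj₁ y → proj₁ (from x) ≡ proj₁ (from y)
    from∘to : ∀ x → proj₁ (from (to x)) ≡ proj₁ x
    to∘from : ∀ y → proj₁ (to (from y)) ≡ proj₁ y

{-# OPTIONS --safe #-}
-- Each elementary operation relates I and J through an affine correspondence
-- β i = α j + c with α, β ≠ 0 (translation by i: α = β = 1, c = -i; symmetry: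
-- α = -1, β = 1, c = n₀ + nₖ; scaling by r: α = ↧ r, β = ↥ r, c = 0).  Since
--   (α β q) j + β (β a + c q) = β² (q i + a),
-- the map (q , a) ↦ (α β q , β (β a + c q)) sends pairs making every q i + a
-- (i ∈ I) a square to pairs making every q j + a (j ∈ J) a square.  Dividing
-- the image by the largest square F² dividing both coordinates makes their gcd
-- squarefree again and keeps the squares (F² X = k² forces F ∣ k).  The map
-- built from (β, α, -c) goes back: the composite multiplies by (α β)² up to
-- square factors, and a pair with squarefree gcd is determined by its class
-- up to nonzero square multiples.

module Submission where

open import Data.Product using (∃-syntax; _×_; _,_; proj₁; proj₂)
open import Data.Sum using (inj₁; inj₂; [_,_]′)
open import Data.Empty using (⊥-elim)
open import Function using (id; _∘_)
open import Relation.Nullary using (yes; no)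
open import Relation.Binary.PropositionalEquality
open import Relation.Binary.Construct.Closure.ReflexiveTransitive using (ε; _◅_)
open import Function.Bundles using (Equivalence)
open Equivalence using (to; from)

open import Defs

module SquareDivisors where
  open import Data.Nat using (ℕ; zero; suc; NonZero; _≤_; z≤n; s≤s⁻¹; _*_; ≢-nonZero; ≢-nonZero⁻¹)
  open import Data.Nat.Properties
    using (m*n≢0; *-identityʳ; *-zeroʳ; m*n≡1⇒m≡1; *-cancelˡ-≡; *-cancelˡ-≤;
           m≤n⇒m<n∨m≡n; ≤-trans; m≤m*n; n≤1⇒n≡0∨n≡1)
  open import Data.Nat.Divisibility
  open import Data.Nat.DivMod using (m*[n/m]≡n; _/_)
  open import Data.Nat.GCD using (gcd; gcd[m,n]∣m; gcd[m,n]∣n; gcd[m,n]≢0)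
  open import Data.Nat.Coprimality as Coprime using (Coprime; coprime-divisor; coprime-/gcd)
  open import Data.Nat.Tactic.RingSolver using (solve-∀)

  coprime-*ʳ-square : ∀ {m n} → Coprime m n → Coprime m (n * n)
  coprime-*ʳ-square {m} {n} m⊥n {i} (i∣m , i∣n*n) = m⊥n (i∣m , coprime-divisor i⊥n i∣n*n)
    where
    i⊥n : Coprime i n
    i⊥n (j∣i , j∣n) = m⊥n (∣-trans j∣i i∣m , j∣n)

  coprime-square : ∀ {m n} → Coprime m n → Coprime (m * m) (n * n)
  coprime-square m⊥n = Coprime.sym (coprime-*ʳ-square (Coprime.sym (coprime-*ʳ-square m⊥n)))

  record CommonFactor (l m : ℕ) : Set where
    field
      h l′ m′     : ℕ
      h≢0         : NonZero h
      l≡h*l′      : l ≡ h * l′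
      m≡h*m′      : m ≡ h * m′
      l′-coprime-m′ : Coprime l′ m′

  commonFactor : ∀ l m .{{_ : NonZero l}} → CommonFactor l m
  commonFactor l m = record
    { h = gcd l m ; l′ = l / gcd l m ; m′ = m / gcd l m
    ; l≡h*l′ = sym (m*[n/m]≡n (gcd[m,n]∣m l m))
    ; m≡h*m′ = sym (m*[n/m]≡n (gcd[m,n]∣n l m))
    ; h≢0 = gcd≢0
    ; l′-coprime-m′ = coprime-/gcd l m }
    where
    instance
      gcd≢0 : NonZero (gcd l m)
      gcd≢0 = ≢-nonZero (gcd[m,n]≢0 l m (inj₁ (≢-nonZero⁻¹ l)))

  square-* : ∀ h x → (h * x) * (h * x) ≡ (h * h) * (x * x)
  square-* = solve-∀

  l*l∣m*m⇒l∣m : ∀ l m .{{_ : NonZero l}} → l * l ∣ m * m → l ∣ m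
  l*l∣m*m⇒l∣m l m l²∣m² = subst₂ _∣_ (sym l≡h*l′) (sym m≡h*m′) h∣h*m′
    where
    open CommonFactor (commonFactor l m)
    instance
      h*h≢0 : NonZero (h * h)
      h*h≢0 = m*n≢0 h h {{h≢0}} {{h≢0}}
    l′²∣m′² : l′ * l′ ∣ m′ * m′ * 1
    l′²∣m′² = subst (l′ * l′ ∣_) (sym (*-identityʳ _)) (*-cancelˡ-∣ (h * h)
      (subst₂ _∣_ (trans (cong (λ z → z * z) l≡h*l′) (square-* h l′))
                  (trans (cong (λ z → z * z) m≡h*m′) (square-* h m′)) l²∣m²))
    l′≡1 : l′ ≡ 1
    l′≡1 = m*n≡1⇒m≡1 l′ l′ (∣1⇒≡1 (coprime-divisor (coprime-square l′-coprime-m′) l′²∣m′²))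
    h∣h*m′ : h * l′ ∣ h * m′
    h∣h*m′ = subst (λ l′ → h * l′ ∣ h * m′) (sym l′≡1) (*-monoʳ-∣ h (1∣ m′))

  l*l*g≡m*m*g′⇒l≡m : ∀ l m {g g′} .{{_ : NonZero l}} → SquareFree g → SquareFree g′ →
                     l * l * g ≡ m * m * g′ → l ≡ m
  l*l*g≡m*m*g′⇒l≡m l m {g} {g′} g-sf g′-sf eq =
    trans l≡h*l′ (trans (cong (h *_) (trans l′≡1 (sym m′≡1))) (sym m≡h*m′))
    where
    open CommonFactor (commonFactor l m)
    instance
      h*h≢0 : NonZero (h * h)
      h*h≢0 = m*n≢0 h h {{h≢0}} {{h≢0}}
    regroup : ∀ h x g → h * x * (h * x) * g ≡ (h * h) * (x * x * g)
    regroup = solve-∀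
    eq′ : l′ * l′ * g ≡ m′ * m′ * g′
    eq′ = *-cancelˡ-≡ _ _ (h * h) (begin
      h * h * (l′ * l′ * g)   ≡⟨ regroup h l′ g ⟨
      h * l′ * (h * l′) * g   ≡⟨ subst₂ (λ a b → a * a * g ≡ b * b * g′) l≡h*l′ m≡h*m′ eq ⟩
      h * m′ * (h * m′) * g′  ≡⟨ regroup h m′ g′ ⟩
      h * h * (m′ * m′ * g′)  ∎)
      where open ≡-Reasoning
    l′≡1 : l′ ≡ 1
    l′≡1 = g′-sf l′ (coprime-divisor (coprime-square l′-coprime-m′) (subst (l′ * l′ ∣_) eq′ (m∣m*n g)))
    m′≡1 : m′ ≡ 1
    m′≡1 = g-sf m′ (coprime-divisor (coprime-square (Coprime.sym l′-coprime-m′))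
                                    (subst (m′ * m′ ∣_) (sym eq′) (m∣m*n g′)))

  squareDivisorRoot : ℕ → ℕ → ℕ
  squareDivisorRoot g zero = 1
  squareDivisorRoot g (suc n) with suc n * suc n ∣? g
  ... | yes _ = suc n
  ... | no  _ = squareDivisorRoot g n

  squareDivisorRoot-nonZero : ∀ g n → NonZero (squareDivisorRoot g n)
  squareDivisorRoot-nonZero g zero = _
  squareDivisorRoot-nonZero g (suc n) with suc n * suc n ∣? g
  ... | yes _ = _
  ... | no  _ = squareDivisorRoot-nonZero g n

  squareDivisorRoot-∣ : ∀ g n → squareDivisorRoot g n * squareDivisorRoot g n ∣ g
  squareDivisorRoot-∣ g zero = 1∣ g
  squareDivisorRoot-∣ g (suc n) with suc n * suc n ∣? g
  ... | yes n²∣g = n²∣g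
  ... | no  _    = squareDivisorRoot-∣ g n

  squareDivisorRoot-max : ∀ g n {d} → d ≤ n → d * d ∣ g → d ≤ squareDivisorRoot g n
  squareDivisorRoot-max g zero    z≤n   _    = z≤n
  squareDivisorRoot-max g (suc n) d≤1+n d²∣g with suc n * suc n ∣? g | m≤n⇒m<n∨m≡n d≤1+n
  ... | yes _   | _          = d≤1+n
  ... | no  _   | inj₁ d<1+n = squareDivisorRoot-max g n (s≤s⁻¹ d<1+n) d²∣g
  ... | no  n²∤g | inj₂ refl = ⊥-elim (n²∤g d²∣g)

  maxSquareDivisorRoot : ℕ → ℕ
  maxSquareDivisorRoot g = squareDivisorRoot g g

  maxSquareDivisorRoot-max : ∀ {g d} .{{_ : NonZero g}} → d * d ∣ g → d ≤ maxSquareDivisorRoot g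
  maxSquareDivisorRoot-max {g} {d} d²∣g = squareDivisorRoot-max g g (≤-trans (m≤m*m d) (∣⇒≤ d²∣g)) d²∣g
    where
    m≤m*m : ∀ m → m ≤ m * m
    m≤m*m zero    = z≤n
    m≤m*m (suc m) = m≤m*n (suc m) (suc m)

  squareFree-cofactor : ∀ {g g′} .{{_ : NonZero g}} →
                        g ≡ maxSquareDivisorRoot g * maxSquareDivisorRoot g * g′ → SquareFree g′
  squareFree-cofactor {g} {g′} g≡F*F*g′ d d²∣g′ =
    [ (λ d≡0 → ⊥-elim (≢-nonZero⁻¹ g (g≡0 d≡0))) , id ]′ (n≤1⇒n≡0∨n≡1 d≤1)
    where
    F : ℕ
    F = maxSquareDivisorRoot g
    instance
      F≢0 : NonZero F
      F≢0 = squareDivisorRoot-nonZero g g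
    [F*d]²∣g : F * d * (F * d) ∣ g
    [F*d]²∣g = subst₂ _∣_ (sym (square-* F d)) (sym g≡F*F*g′) (*-monoʳ-∣ (F * F) d²∣g′)
    d≤1 : d ≤ 1
    d≤1 = *-cancelˡ-≤ F (subst (F * d ≤_) (sym (*-identityʳ F)) (maxSquareDivisorRoot-max [F*d]²∣g))
    g≡0 : d ≡ 0 → g ≡ 0
    g≡0 d≡0 = trans g≡F*F*g′
      (trans (cong (F * F *_) (0∣⇒≡0 (subst (λ e → e * e ∣ g′) d≡0 d²∣g′))) (*-zeroʳ (F * F)))

open SquareDivisors

import Data.Nat as ℕ
import Data.Nat.Properties as ℕ
import Data.Nat.Divisibility as ℕ
open import Data.Nat using (ℕ; suc)
open import Data.Nat.GCD using (gcd; c*gcd[m,n]≡gcd[cm,cn]; gcd[m,n]∣m; gcd[m,n]∣n; gcd[m,n]≢0)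
open import Data.Integer using (ℤ; +_; -[1+_]; ∣_∣; -_; _+_; _*_; 0ℤ; 1ℤ; -1ℤ; NonZero; ≢-nonZero)
open import Data.Integer.Properties
  using (neg-involutive; i*j≢0; abs-*; pos-*; pos-+; *-comm; *-assoc; *-cancelˡ-≡; *-zeroʳ; *-identityʳ; +-identityʳ;
         ∣i∣≡0⇒i≡0; i*j≡0⇒i≡0∨j≡0; +◃n≡+n; 0≤i⇒+∣i∣≡i)
open import Data.Integer.Divisibility.Signed using (_∣_; ∣ᵤ⇒∣; quotient)
open _∣_ using (equality)
open import Data.Integer.GCD using (gcd-zeroʳ)
open import Data.Integer.Tactic.RingSolver using (solve-∀)
open import Data.Rational as ℚ using (↥_; ↧_)
open import Data.Rational.Properties using (↥-/; ↧-/; toℚᵘ-cong; toℚᵘ-homo-*; ↥p≡0⇒p≡0)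
import Data.Rational.Unnormalised as ℚᵘ
open import Data.Rational.Unnormalised.Properties using (≃-trans)
open import Data.List.Membership.Propositional using (_∈_)

content : ℤ × ℤ → ℕ
content (q , a) = gcd ∣ q ∣ ∣ a ∣

AllSquares : FinSubset → ℤ × ℤ → Set
AllSquares I (q , a) = ∀ i → i ∈ I → ∃[ k ] (q * + i + a ≡ k * k)

infixr 5 _·_

_·_ : ℤ → ℤ × ℤ → ℤ × ℤ
k · x = k * proj₁ x , k * proj₂ x

·-assoc : ∀ k l x → k · l · x ≡ (k * l) · x
·-assoc k l x = cong₂ _,_ (sym (*-assoc k l _)) (sym (*-assoc k l _))

·-cancelˡ : ∀ k .{{_ : NonZero k}} {x y} → k · x ≡ k · y → x ≡ y
·-cancelˡ k eq = cong₂ _,_ (*-cancelˡ-≡ k _ _ (cong proj₁ eq)) (*-cancelˡ-≡ k _ _ (cong proj₂ eq))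

content-· : ∀ k x → content (k · x) ≡ ∣ k ∣ ℕ.* content x
content-· k (q , a) =
  trans (cong₂ gcd (abs-* k q) (abs-* k a)) (sym (c*gcd[m,n]≡gcd[cm,cn] (∣ k ∣) (∣ q ∣) (∣ a ∣)))

content-square· : ∀ k x → content (k * k · x) ≡ ∣ k ∣ ℕ.* ∣ k ∣ ℕ.* content x
content-square· k x = trans (content-· (k * k) x) (cong (ℕ._* content x) (abs-* k k))

content≢0 : ∀ x → proj₁ x ≢ 0ℤ → content x ≢ 0
content≢0 x q≢0 = gcd[m,n]≢0 _ _ (inj₁ (λ ∣q∣≡0 → q≢0 (∣i∣≡0⇒i≡0 ∣q∣≡0)))

*-≢0 : ∀ {i j} → i ≢ 0ℤ → j ≢ 0ℤ → i * j ≢ 0ℤ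
*-≢0 {i} i≢0 j≢0 i*j≡0 = [ i≢0 , j≢0 ]′ (i*j≡0⇒i≡0∨j≡0 i i*j≡0)

square≡+∣∣*∣∣ : ∀ k → k * k ≡ + (∣ k ∣ ℕ.* ∣ k ∣)
square≡+∣∣*∣∣ (+ n)    = sym (pos-* n n)
square≡+∣∣*∣∣ -[1+ n ] = +◃n≡+n (suc n ℕ.* suc n)

square·-cancel : ∀ k l {x y} → k ≢ 0ℤ →
                 SquareFree (content x) → SquareFree (content y) →
                 k * k · x ≡ l * l · y → x ≡ y
square·-cancel k l {x} {y} k≢0 x-sf y-sf eq = ·-cancelˡ (k * k) (trans eq (cong (_· y) (sym k*k≡l*l)))
  where
  instance
    k≢0ℕ : ℕ.NonZero ∣ k ∣
    k≢0ℕ = ℕ.≢-nonZero (λ ∣k∣≡0 → k≢0 (∣i∣≡0⇒i≡0 ∣k∣≡0))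
    k*k≢0 : NonZero (k * k)
    k*k≢0 = ≢-nonZero (*-≢0 k≢0 k≢0)
  ∣k∣≡∣l∣ : ∣ k ∣ ≡ ∣ l ∣
  ∣k∣≡∣l∣ = l*l*g≡m*m*g′⇒l≡m ∣ k ∣ ∣ l ∣ x-sf y-sf
    (trans (sym (content-square· k x)) (trans (cong content eq) (content-square· l y)))
  k*k≡l*l : k * k ≡ l * l
  k*k≡l*l = trans (square≡+∣∣*∣∣ k) (trans (cong (λ n → + (n ℕ.* n)) ∣k∣≡∣l∣) (sym (square≡+∣∣*∣∣ l)))

squareFactor : ℤ × ℤ → ℕ
squareFactor x = maxSquareDivisorRoot (content x)

squareFactor-nonZero : ∀ x → ℕ.NonZero (squareFactor x)
squareFactor-nonZero x = squareDivisorRoot-nonZero (content x) (content x)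

squareFactor²∣ : ∀ x z → content x ℕ.∣ ∣ z ∣ → + (squareFactor x ℕ.* squareFactor x) ∣ z
squareFactor²∣ x z content∣z = ∣ᵤ⇒∣ (ℕ.∣-trans (squareDivisorRoot-∣ (content x) (content x)) content∣z)

squareFactor²∣proj₁ : ∀ x → + (squareFactor x ℕ.* squareFactor x) ∣ proj₁ x
squareFactor²∣proj₁ x@(q , a) = squareFactor²∣ x q (gcd[m,n]∣m ∣ q ∣ ∣ a ∣)

squareFactor²∣proj₂ : ∀ x → + (squareFactor x ℕ.* squareFactor x) ∣ proj₂ x
squareFactor²∣proj₂ x@(q , a) = squareFactor²∣ x a (gcd[m,n]∣n ∣ q ∣ ∣ a ∣)

-- opaque: downstream only normalise-spec is used, and unfolding the gcd in types is costly
opaque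
  normalise : ℤ × ℤ → ℤ × ℤ
  normalise x = quotient (squareFactor²∣proj₁ x) , quotient (squareFactor²∣proj₂ x)

  normalise-spec : ∀ x → let F = + squareFactor x in x ≡ F * F · normalise x
  normalise-spec x = cong₂ _,_ (divided (squareFactor²∣proj₁ x)) (divided (squareFactor²∣proj₂ x))
    where
    F : ℕ
    F = squareFactor x
    divided : ∀ {z} (F²∣z : + (F ℕ.* F) ∣ z) → z ≡ + F * + F * quotient F²∣z
    divided F²∣z = trans (equality F²∣z) (trans (*-comm _ (+ (F ℕ.* F))) (cong (_* quotient F²∣z) (pos-* F F)))

normalise-≢0 : ∀ x → proj₁ x ≢ 0ℤ → proj₁ (normalise x) ≢ 0ℤ
normalise-≢0 x q≢0 q′≡0 = q≢0 (begin
  proj₁ x                          ≡⟨ cong proj₁ (normalise-spec x) ⟩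
  F * F * proj₁ (normalise x)      ≡⟨ cong (F * F *_) q′≡0 ⟩
  F * F * 0ℤ                       ≡⟨ *-zeroʳ (F * F) ⟩
  0ℤ                               ∎)
  where
  open ≡-Reasoning
  F : ℤ
  F = + squareFactor x

normalise-squareFree : ∀ x → proj₁ x ≢ 0ℤ → SquareFree (content (normalise x))
normalise-squareFree x q≢0 = squareFree-cofactor {{ℕ.≢-nonZero (content≢0 x q≢0)}}
  (trans (cong content (normalise-spec x)) (content-square· (+ squareFactor x) (normalise x)))

cofactor-square : ∀ f .{{_ : ℕ.NonZero f}} X k → + f * + f * X ≡ k * k → ∃[ s ] (X ≡ s * s)
cofactor-square f X k f²X≡k² = + s , *-cancelˡ-≡ (+ f * + f) X (+ s * + s) {{i*j≢0 (+ f) (+ f)}} (begin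
  + f * + f * X                 ≡⟨ f²X≡k² ⟩
  k * k                         ≡⟨ square≡+∣∣*∣∣ k ⟩
  + (∣ k ∣ ℕ.* ∣ k ∣)             ≡⟨ cong (λ n → + (n ℕ.* n)) ∣k∣≡s*f ⟩
  + (s ℕ.* f ℕ.* (s ℕ.* f))       ≡⟨ pos-* (s ℕ.* f) (s ℕ.* f) ⟩
  + (s ℕ.* f) * + (s ℕ.* f)       ≡⟨ cong₂ _*_ (pos-* s f) (pos-* s f) ⟩
  + s * + f * (+ s * + f)       ≡⟨ regroup (+ s) (+ f) ⟩
  + f * + f * (+ s * + s)       ∎)
  where
  open ≡-Reasoning
  f²∣∣k∣² : f ℕ.* f ℕ.∣ ∣ k ∣ ℕ.* ∣ k ∣
  f²∣∣k∣² = ℕ.divides ∣ X ∣ (begin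
    ∣ k ∣ ℕ.* ∣ k ∣             ≡⟨ abs-* k k ⟨
    ∣ k * k ∣                  ≡⟨ cong ∣_∣ f²X≡k² ⟨
    ∣ + f * + f * X ∣          ≡⟨ abs-* (+ f * + f) X ⟩
    ∣ + f * + f ∣ ℕ.* ∣ X ∣     ≡⟨ cong (ℕ._* ∣ X ∣) (abs-* (+ f) (+ f)) ⟩
    f ℕ.* f ℕ.* ∣ X ∣           ≡⟨ ℕ.*-comm (f ℕ.* f) ∣ X ∣ ⟩
    ∣ X ∣ ℕ.* (f ℕ.* f)         ∎)
  f∣∣k∣ : f ℕ.∣ ∣ k ∣
  f∣∣k∣ = l*l∣m*m⇒l∣m f ∣ k ∣ f²∣∣k∣²
  s : ℕ
  s = ℕ.quotient f∣∣k∣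
  ∣k∣≡s*f : ∣ k ∣ ≡ s ℕ.* f
  ∣k∣≡s*f = ℕ._∣_.equality f∣∣k∣
  regroup : ∀ s f → s * f * (s * f) ≡ f * f * (s * s)
  regroup = solve-∀

normalise-squares : ∀ {I} x → AllSquares I x → AllSquares I (normalise x)
normalise-squares x squares i i∈I with squares i i∈I
... | k , qi+a≡k² = cofactor-square F {{squareFactor-nonZero x}} (proj₁ n * + i + proj₂ n) k (begin
  + F * + F * (proj₁ n * + i + proj₂ n)              ≡⟨ distrib (+ F * + F) (proj₁ n) (+ i) (proj₂ n) ⟩
  + F * + F * proj₁ n * + i + + F * + F * proj₂ n    ≡⟨ cong (λ p → proj₁ p * + i + proj₂ p) (normalise-spec x) ⟨
  proj₁ x * + i + proj₂ x                           ≡⟨ qi+a≡k² ⟩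
  k * k                                             ∎)
  where
  open ≡-Reasoning
  F : ℕ
  F = squareFactor x
  n : ℤ × ℤ
  n = normalise x
  distrib : ∀ c q i a → c * (q * i + a) ≡ c * q * i + c * a
  distrib = solve-∀

normalise-InZ : ∀ {I} x → proj₁ x ≢ 0ℤ → AllSquares I x → InZ I (normalise x)
normalise-InZ x q≢0 squares = normalise-squareFree x q≢0 , normalise-≢0 x q≢0 , normalise-squares x squares

AffineCover : ℤ → ℤ → ℤ → FinSubset → FinSubset → Set
AffineCover α β c I J = ∀ j → j ∈ J → ∃[ i ] (i ∈ I × β * + i ≡ α * + j + c)

affine : ℤ → ℤ → ℤ → ℤ × ℤ → ℤ × ℤ
affine α β c x = α * β * proj₁ x , β * (β * proj₂ x + c * proj₁ x)

affine-squares : ∀ {I J} α β c → AffineCover α β c I J →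
                 ∀ x → AllSquares I x → AllSquares J (affine α β c x)
affine-squares α β c cover (q , a) squares j j∈J with cover j j∈J
... | i , i∈I , βi≡αj+c with squares i i∈I
...   | k , qi+a≡k² = β * k , (begin
  α * β * q * + j + β * (β * a + c * q)   ≡⟨ regroup₁ α β c q a (+ j) ⟩
  β * q * (α * + j + c) + β * β * a       ≡⟨ cong (λ z → β * q * z + β * β * a) βi≡αj+c ⟨
  β * q * (β * + i) + β * β * a           ≡⟨ regroup₂ β q a (+ i) ⟩
  β * β * (q * + i + a)                   ≡⟨ cong (β * β *_) qi+a≡k² ⟩
  β * β * (k * k)                         ≡⟨ regroup₃ β k ⟩
  β * k * (β * k)                         ∎)
  where
  open ≡-Reasoning
  regroup₁ : ∀ α β c q a j → α * β * q * j + β * (β * a + c * q) ≡ β * q * (α * j + c) + β * β * a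
  regroup₁ = solve-∀
  regroup₂ : ∀ β q a i → β * q * (β * i) + β * β * a ≡ β * β * (q * i + a)
  regroup₂ = solve-∀
  regroup₃ : ∀ β k → β * β * (k * k) ≡ β * k * (β * k)
  regroup₃ = solve-∀

affine-· : ∀ α β c k x → affine α β c (k · x) ≡ k · affine α β c x
affine-· α β c k (q , a) = cong₂ _,_ (lemma₁ α β k q) (lemma₂ α β c k q a)
  where
  lemma₁ : ∀ α β k q → α * β * (k * q) ≡ k * (α * β * q)
  lemma₁ = solve-∀
  lemma₂ : ∀ α β c k q a → β * (β * (k * a) + c * (k * q)) ≡ k * (β * (β * a + c * q))
  lemma₂ = solve-∀

affine-inverse : ∀ α β c x → affine β α (- c) (affine α β c x) ≡ α * β * (α * β) · x
affine-inverse α β c (q , a) = cong₂ _,_ (lemma₁ α β q) (lemma₂ α β c q a)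
  where
  lemma₁ : ∀ α β q → β * α * (α * β * q) ≡ α * β * (α * β) * q
  lemma₁ = solve-∀
  lemma₂ : ∀ α β c q a → α * (α * (β * (β * a + c * q)) + - c * (α * β * q)) ≡ α * β * (α * β) * a
  lemma₂ = solve-∀

transport : ℤ → ℤ → ℤ → ℤ × ℤ → ℤ × ℤ
transport α β c x = normalise (affine α β c x)

transport-InZ : ∀ {I J α β} c → α ≢ 0ℤ → β ≢ 0ℤ → AffineCover α β c I J →
                ∀ x → InZ I x → InZ J (transport α β c x)
transport-InZ {α = α} {β} c α≢0 β≢0 cover x (_ , q≢0 , squares) =
  normalise-InZ (affine α β c x) (*-≢0 (*-≢0 α≢0 β≢0) q≢0) (affine-squares α β c cover x squares)

transport-inverse : ∀ {α β} c → α ≢ 0ℤ → β ≢ 0ℤ → ∀ x → SquareFree (content x) → proj₁ x ≢ 0ℤ →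
                    transport β α (- c) (transport α β c x) ≡ x
transport-inverse {α} {β} c α≢0 β≢0 x x-sf q≢0 =
  sym (square·-cancel (α * β) (F₁ * F₂) αβ≢0 x-sf n₂-sf (begin
  α * β * (α * β) · x         ≡⟨ affine-inverse α β c x ⟨
  affine′ y                   ≡⟨ cong affine′ (normalise-spec y) ⟩
  affine′ (F₁ * F₁ · n₁)      ≡⟨ affine-· β α (- c) (F₁ * F₁) n₁ ⟩
  F₁ * F₁ · affine′ n₁        ≡⟨ cong (F₁ * F₁ ·_) (normalise-spec (affine′ n₁)) ⟩
  F₁ * F₁ · F₂ * F₂ · n₂      ≡⟨ ·-assoc (F₁ * F₁) (F₂ * F₂) n₂ ⟩
  F₁ * F₁ * (F₂ * F₂) · n₂    ≡⟨ cong (_· n₂) (regroup F₁ F₂) ⟩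
  F₁ * F₂ * (F₁ * F₂) · n₂    ∎))
  where
  open ≡-Reasoning
  affine′ : ℤ × ℤ → ℤ × ℤ
  affine′ = affine β α (- c)
  y n₁ n₂ : ℤ × ℤ
  y  = affine α β c x
  n₁ = normalise y
  n₂ = normalise (affine′ n₁)
  F₁ F₂ : ℤ
  F₁ = + squareFactor y
  F₂ = + squareFactor (affine′ n₁)
  αβ≢0 : α * β ≢ 0ℤ
  αβ≢0 = *-≢0 α≢0 β≢0
  n₂-sf : SquareFree (content n₂)
  n₂-sf = normalise-squareFree (affine′ n₁) (*-≢0 (*-≢0 β≢0 α≢0) (normalise-≢0 y (*-≢0 αβ≢0 q≢0)))
  regroup : ∀ f g → f * f * (g * g) ≡ f * g * (f * g)
  regroup = solve-∀

sameCard : ∀ {I J} (f g : ℤ × ℤ → ℤ × ℤ) →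
           (∀ x → InZ I x → InZ J (f x)) → (∀ y → InZ J y → InZ I (g y)) →
           (∀ x → InZ I x → g (f x) ≡ x) → (∀ y → InZ J y → f (g y) ≡ y) → SameCard I J
sameCard f g f-InZ g-InZ g∘f f∘g = record
  { to      = λ (x , x∈) → f x , f-InZ x x∈
  ; from    = λ (y , y∈) → g y , g-InZ y y∈
  ; to-wd   = λ _ _ → cong f
  ; from-wd = λ _ _ → cong g
  ; from∘to = λ (x , x∈) → g∘f x x∈
  ; to∘from = λ (y , y∈) → f∘g y y∈
  }

sameCard-refl : ∀ {I} → SameCard I I
sameCard-refl = sameCard id id (λ _ → id) (λ _ → id) (λ _ _ → refl) (λ _ _ → refl)

sameCard-trans : ∀ {I J K} → SameCard I J → SameCard J K → SameCard I K
sameCard-trans I≈J J≈K = record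
  { to      = λ x → B.to (A.to x)
  ; from    = λ z → A.from (B.from z)
  ; to-wd   = λ x y eq → B.to-wd _ _ (A.to-wd x y eq)
  ; from-wd = λ x y eq → A.from-wd _ _ (B.from-wd x y eq)
  ; from∘to = λ x → trans (A.from-wd _ _ (B.from∘to (A.to x))) (A.from∘to x)
  ; to∘from = λ z → trans (B.to-wd _ _ (A.to∘from (B.from z))) (B.to∘from z)
  }
  where
  module A = SameCard I≈J
  module B = SameCard J≈K

sameCard-affine : ∀ {I J} α β c → α ≢ 0ℤ → β ≢ 0ℤ →
                  AffineCover α β c I J → AffineCover β α (- c) J I → SameCard I J
sameCard-affine α β c α≢0 β≢0 I→J J→I = sameCard (transport α β c) (transport β α (- c))
  (transport-InZ c α≢0 β≢0 I→J) (transport-InZ (- c) β≢0 α≢0 J→I)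
  (λ x (x-sf , q≢0 , _) → transport-inverse c α≢0 β≢0 x x-sf q≢0)
  (λ y (y-sf , q≢0 , _) → trans (cong (λ c′ → transport α β c′ (transport β α (- c) y)) (sym (neg-involutive c)))
                               (transport-inverse (- c) β≢0 α≢0 y y-sf q≢0))

↥ℕtoℚ : ∀ n → ↥ ℕtoℚ n ≡ + n
↥ℕtoℚ n = trans (sym (*-identityʳ _)) (trans (cong (↥ ℕtoℚ n *_) (sym (gcd-zeroʳ (+ n)))) (↥-/ (+ n) 1))

↧ℕtoℚ : ∀ n → ↧ ℕtoℚ n ≡ 1ℤ
↧ℕtoℚ n = trans (sym (*-identityʳ _)) (trans (cong (↧ ℕtoℚ n *_) (sym (gcd-zeroʳ (+ n)))) (↧-/ (+ n) 1))

cross-multiply : ∀ p r q → p ≡ r ℚ.* q → ↥ p * (↧ r * ↧ q) ≡ ↥ r * ↥ q * ↧ p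
cross-multiply p@record{} r@record{} q@record{} p≡rq with ≃-trans (toℚᵘ-cong p≡rq) (toℚᵘ-homo-* r q)
... | ℚᵘ.*≡* eq = eq

ℕtoℚ-cross-multiply : ∀ r s t → ℕtoℚ t ≡ r ℚ.* ℕtoℚ s → ↧ r * + t ≡ ↥ r * + s
ℕtoℚ-cross-multiply r s t t≡rs = begin
  ↧ r * + t                             ≡⟨ regroup (↧ r) (+ t) ⟩
  + t * (↧ r * 1ℤ)                      ≡⟨ cong₂ (λ u v → u * (↧ r * v)) (↥ℕtoℚ t) (↧ℕtoℚ s) ⟨
  ↥ ℕtoℚ t * (↧ r * ↧ ℕtoℚ s)           ≡⟨ cross-multiply (ℕtoℚ t) r (ℕtoℚ s) t≡rs ⟩
  ↥ r * ↥ ℕtoℚ s * ↧ ℕtoℚ t             ≡⟨ cong₂ (λ u v → ↥ r * u * v) (↥ℕtoℚ s) (↧ℕtoℚ t) ⟩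
  ↥ r * + s * 1ℤ                        ≡⟨ *-identityʳ _ ⟩
  ↥ r * + s                             ∎
  where
  open ≡-Reasoning
  regroup : ∀ d t → d * t ≡ t * (d * 1ℤ)
  regroup = solve-∀

translation⇒sameCard : ∀ {I J} → Translation I J → SameCard I J
translation⇒sameCard {I} {J} (i , nonneg , J⇔I+i) = sameCard-affine 1ℤ 1ℤ (- i) (λ ()) (λ ()) I→J J→I
  where
  backward : ∀ n i → 1ℤ * n ≡ 1ℤ * (n + i) + - i
  backward = solve-∀
  forward : ∀ n i → 1ℤ * (n + i) ≡ 1ℤ * n + - - i
  forward = solve-∀
  I→J : AffineCover 1ℤ 1ℤ (- i) I J
  I→J j j∈J with J⇔I+i j .to j∈J
  ... | n , n∈I , j≡n+i = n , n∈I , trans (backward (+ n) i) (cong (λ z → 1ℤ * z + - i) (sym j≡n+i))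
  J→I : AffineCover 1ℤ 1ℤ (- - i) J I
  J→I n n∈I = ∣ + n + i ∣ , J⇔I+i _ .from (n , n∈I , j≡n+i) , trans (cong (1ℤ *_) j≡n+i) (forward (+ n) i)
    where
    j≡n+i : + ∣ + n + i ∣ ≡ + n + i
    j≡n+i = 0≤i⇒+∣i∣≡i (nonneg n n∈I)

symmetry⇒sameCard : ∀ {I J} → Symmetry I J → SameCard I J
symmetry⇒sameCard {I} {J} (n₀ , nₖ , _ , _ , bounds , J⇔N-I) =
  sameCard-affine -1ℤ 1ℤ (+ N) (λ ()) (λ ()) I→J J→I
  where
  N : ℕ
  N = n₀ ℕ.+ nₖ
  reflect : ∀ j n → j ℕ.+ n ≡ N → + N ≡ + j + + n
  reflect j n j+n≡N = trans (cong +_ (sym j+n≡N)) (pos-+ j n)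
  backward : ∀ j n → 1ℤ * n ≡ -1ℤ * j + (j + n)
  backward = solve-∀
  forward : ∀ j n → -1ℤ * j ≡ 1ℤ * n + - (j + n)
  forward = solve-∀
  I→J : AffineCover -1ℤ 1ℤ (+ N) I J
  I→J j j∈J with J⇔N-I j .to j∈J
  ... | n , n∈I , j+n≡N =
    n , n∈I , trans (backward (+ j) (+ n)) (cong (λ z → -1ℤ * + j + z) (sym (reflect j n j+n≡N)))
  J→I : AffineCover 1ℤ -1ℤ (- + N) J I
  J→I n n∈I = j , J⇔N-I j .from (n , n∈I , j+n≡N)
            , trans (forward (+ j) (+ n)) (cong (λ z → 1ℤ * + n + - z) (sym (reflect j n j+n≡N)))
    where
    j : ℕ
    j = N ℕ.∸ n
    j+n≡N : j ℕ.+ n ≡ N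
    j+n≡N = ℕ.m∸n+n≡m (ℕ.≤-trans (proj₂ (bounds n n∈I)) (ℕ.m≤n+m nₖ n₀))

scaling⇒sameCard : ∀ {I J} → Scaling I J → SameCard I J
scaling⇒sameCard {I} {J} (r , r≢0 , integral , J⇔rI) =
  sameCard-affine (↧ r) (↥ r) 0ℤ (λ ()) (r≢0 ∘ ↥p≡0⇒p≡0 r) I→J J→I
  where
  I→J : AffineCover (↧ r) (↥ r) 0ℤ I J
  I→J t t∈J with J⇔rI t .to t∈J
  ... | s , s∈I , t≡rs = s , s∈I , trans (sym (ℕtoℚ-cross-multiply r s t t≡rs)) (sym (+-identityʳ _))
  J→I : AffineCover (↥ r) (↧ r) (- 0ℤ) J I
  J→I s s∈I with integral s s∈I
  ... | t , rs≡t =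
    t , J⇔rI t .from (s , s∈I , sym rs≡t) , trans (ℕtoℚ-cross-multiply r s t (sym rs≡t)) (sym (+-identityʳ _))

step⇒sameCard : ∀ {I J} → Step I J → SameCard I J
step⇒sameCard (translation t) = translation⇒sameCard t
step⇒sameCard (scaling s)     = scaling⇒sameCard s
step⇒sameCard (symmetry s)    = symmetry⇒sameCard s

mainTheorem2 : (I J : FinSubset) → I ∼ J → SameCard I J
mainTheorem2 I .I ε        = sameCard-refl
mainTheorem2 I J (s ◅ ss) = sameCard-trans (step⇒sameCard s) (mainTheorem2 _ J ss)
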